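{- There is an algorithm which, given a positive integer $n$, a set $\mathsf F$ that is the palindromic fingerprint of some string of length $n$, and a positive integer $k$, outputs a string $T$ of length $n$ whose palindromic fingerprint is $\mathsf F$ and which contains exactly $k$ distinct symbols, whenever such a string exists (and reports that none exists otherwise).
   Context: For a string $S$ of length $n$, $S[i..j]=S[i]\cdots S[j]$, and $S[i..i-1]$ is the empty string. A palindrome is a string equal to its reversal. A substring $S[i..j]$ (possibly empty, $j=i-1$) is a maximal palindrome if it is a palindrome and $S[i-1..j+1]$ is either undefined (i.e. $i=1$ or $j=n$) or not a palindrome; there is exactly one maximal palindrome for each of the $2n-1$ possible centers (each position and each gap between consecutive positions). The palindromic fingerprint of $S$ is the set of all pairs $(i,j)$ such that $S[i..j]$ is a maximal palindrome (empty maximal palindromes being recorded as $(i,i-1)$), together with its length $n=|S|$. A string $T$ is a reconstruction of $\mathsf F$ if $|T|=n$ and the fingerprint of $T$ is $\mathsf F$. -}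

module Defs where

open import Data.Nat using (ℕ; zero; suc; _+_; _∸_; _≤_; _<_)
open import Data.Product using (Σ; _×_; ∃-syntax)
open import Data.Sum using (_⊎_)
open import Data.List using (List; length)
open import Data.List.Relation.Unary.Unique.Propositional using (Unique)
open import Data.List.Membership.Propositional using (_∈_)
open import Data.Vec using (Vec; []; _∷_)
open import Data.Vec.Membership.Propositional using () renaming (_∈_ to _∈ᵥ_)
open import Relation.Binary.PropositionalEquality using (_≡_)
open import Relation.Nullary using (¬_)
open import Function.Bundles using (_⇔_)

-- Strings of length n over the alphabet ℕ are vectors Vec ℕ n.
-- 1-based character access: at S p = S[p] for 1 ≤ p ≤ n (junk value 0 otherwise;
-- it is only ever used at positions in range).
at : ∀ {n} → Vec ℕ n → ℕ → ℕ
at []       _             = 0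
at (x ∷ xs) zero          = 0
at (x ∷ xs) (suc zero)    = x
at (x ∷ xs) (suc (suc p)) = at xs (suc p)

IsPal : ∀ {n} → Vec ℕ n → ℕ → ℕ → Set
IsPal S i j = ∀ p → i ≤ p → p ≤ j → at S p ≡ at S ((i + j) ∸ p)

-- S[i..j] is a maximal palindrome (1-based, possibly empty with j = i - 1).
-- Only the 2n-1 genuine centers are allowed: a nonempty substring (i ≤ j),
-- or an empty one (i = j + 1) lying in a gap between two positions (1 ≤ j < n).
MaxPal : ∀ {n} → Vec ℕ n → ℕ → ℕ → Set
MaxPal {n} S i j =
  1 ≤ i × j ≤ n ×
  (i ≤ j ⊎ (i ≡ suc j × 1 ≤ j × j < n)) ×
  IsPal S i j ×
  (i ≡ 1 ⊎ j ≡ n ⊎ (1 < i × j < n × ¬ IsPal S (i ∸ 1) (suc j)))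

HasFingerprint : ∀ {n} → Vec ℕ n → List (ℕ × ℕ) → Set
HasFingerprint S F = ∀ i j → ((i Data.Product., j) ∈ F) ⇔ MaxPal S i j

IsFingerprint : ℕ → List (ℕ × ℕ) → Set
IsFingerprint n F = ∃[ S ] HasFingerprint {n} S F

DistinctSymbols : ∀ {n} → Vec ℕ n → ℕ → Set
DistinctSymbols S k =
  Σ (List ℕ) λ L → Unique L × length L ≡ k × (∀ a → (a ∈ L) ⇔ (a ∈ᵥ S))

{-# OPTIONS --safe #-}
module Submission where

-- Whether a string has fingerprint F depends only on which pairs of its positions carry
-- equal symbols.  Hence a reconstruction with exactly k distinct symbols can be renamed,
-- symbol ↦ its index in the list of symbols, into one over the alphabet {0, …, k-1} that
-- uses every letter.  Only finitely many strings of length n live over that alphabet, and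
-- "has fingerprint F and uses every letter" is decidable for each, so exhaustive search
-- decides existence.

open import Defs
open import Data.Nat using (ℕ; zero; suc; _+_; _∸_; _≤_; _<_; z≤n; s≤s; s≤s⁻¹; _≟_; _≤?_; _<?_)
open import Data.Nat.Properties using (≤-trans; m+n∸n≡m; m+n∸m≡n; ∸-monoʳ-≤; suc-injective; anyUpTo?; allUpTo?)
open import Data.Product using (_×_; _,_; proj₁; proj₂; ∃-syntax)
open import Data.Sum using (_⊎_; inj₁; inj₂)
open import Data.List using (List; []; _∷_; length; upTo)
open import Data.List.Properties using (length-upTo)
open import Data.List.Relation.Unary.Any using (here; there)
import Data.List.Relation.Unary.All as ListAll
open import Data.List.Relation.Unary.AllPairs using (_∷_)
open import Data.List.Membership.Propositional using (_∈_)
open import Data.List.Membership.Propositional.Properties using (∈-upTo⁺; ∈-upTo⁻)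
open import Data.List.Relation.Unary.Unique.Propositional using (Unique)
open import Data.List.Relation.Unary.Unique.Propositional.Properties using (upTo⁺)
open import Data.Vec using (Vec; []; _∷_; map)
import Data.Vec.Relation.Unary.Any as VecAny
open import Data.Vec.Relation.Unary.All as VecAll using (All; []; _∷_)
open import Data.Vec.Relation.Unary.All.Properties using (map⁺; lookup⁻)
open import Data.Vec.Membership.Propositional using () renaming (_∈_ to _∈ᵥ_)
open import Data.Vec.Membership.Propositional.Properties using (∈-map⁺; ∈-lookup)
open import Data.Vec.Membership.DecPropositional _≟_ using () renaming (_∈?_ to _∈ᵥ?_)
open import Function.Bundles using (_⇔_; mk⇔; Equivalence)
open import Function.Construct.Composition using (_⇔-∘_)
open import Function.Construct.Symmetry using (⇔-sym)
open import Relation.Binary.Definitions using (DecidableEquality)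
open import Relation.Binary.PropositionalEquality using (_≡_; _≢_; refl; sym; trans; cong; subst)
open import Relation.Nullary using (Dec; yes; no; ¬_; contradiction)
open import Relation.Nullary.Decidable using (map′; _×-dec_; _⊎-dec_; _→-dec_; ¬?)

open Equivalence using (to; from)

isPal? : ∀ {n} (S : Vec ℕ n) i j → Dec (IsPal S i j)
isPal? S i j =
  map′ (λ h p i≤p p≤j → h (s≤s p≤j) i≤p) (λ h {p} p<1+j i≤p → h p i≤p (s≤s⁻¹ p<1+j))
       (allUpTo? (λ p → (i ≤? p) →-dec (at S p ≟ at S ((i + j) ∸ p))) (suc j))

maxPal? : ∀ {n} (S : Vec ℕ n) i j → Dec (MaxPal S i j)
maxPal? {n} S i j =
  (1 ≤? i) ×-dec (j ≤? n) ×-dec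
  ((i ≤? j) ⊎-dec ((i ≟ suc j) ×-dec (1 ≤? j) ×-dec (j <? n))) ×-dec
  isPal? S i j ×-dec
  ((i ≟ 1) ⊎-dec (j ≟ n) ⊎-dec ((1 <? i) ×-dec (j <? n) ×-dec ¬? (isPal? S (i ∸ 1) (suc j))))

maxPal⇒≤ : ∀ {n} {S : Vec ℕ n} {i j} → MaxPal S i j → i ≤ n × j ≤ n
maxPal⇒≤ (_ , j≤n , inj₁ i≤j , _)             = ≤-trans i≤j j≤n , j≤n
maxPal⇒≤ (_ , j≤n , inj₂ (refl , _ , j<n) , _) = j<n , j≤n

SameMaxPals : ∀ {n} → Vec ℕ n → Vec ℕ n → Set
SameMaxPals S T = ∀ i j → MaxPal S i j ⇔ MaxPal T i j

sameMaxPals? : ∀ {n} (S T : Vec ℕ n) → Dec (SameMaxPals S T)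
sameMaxPals? {n} S T =
  map′ (λ h i j → mk⇔ (λ m → let i≤n , j≤n = maxPal⇒≤ {S = S} m in proj₁ (h (s≤s i≤n) (s≤s j≤n)) m)
                      (λ m → let i≤n , j≤n = maxPal⇒≤ {S = T} m in proj₂ (h (s≤s i≤n) (s≤s j≤n)) m))
       (λ same {i} _ {j} _ → to (same i j) , from (same i j))
       (allUpTo? (λ i → allUpTo? (λ j → (maxPal? S i j →-dec maxPal? T i j)
                                        ×-dec (maxPal? T i j →-dec maxPal? S i j)) (suc n)) (suc n))

sameMaxPals⇒hasFingerprint : ∀ {n} (S T : Vec ℕ n) {F} →
  HasFingerprint S F → SameMaxPals S T → HasFingerprint T F
sameMaxPals⇒hasFingerprint _ _ fpS same i j = same i j ⇔-∘ fpS i j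

hasFingerprint⇒sameMaxPals : ∀ {n} (S T : Vec ℕ n) {F} →
  HasFingerprint S F → HasFingerprint T F → SameMaxPals S T
hasFingerprint⇒sameMaxPals _ _ fpS fpT i j = fpT i j ⇔-∘ ⇔-sym (fpS i j)

record PreservesEqualities {n} (S T : Vec ℕ n) : Set where
  constructor preservesEqualities
  field
    transfer : ∀ {p q} → 1 ≤ p → p ≤ n → 1 ≤ q → q ≤ n → at S p ≡ at S q → at T p ≡ at T q

mirror-≤ : ∀ {i j p} → i ≤ p → p ≤ j → i ≤ (i + j) ∸ p × (i + j) ∸ p ≤ j
mirror-≤ {i} {j} {p} i≤p p≤j =
  subst (_≤ (i + j) ∸ p) (m+n∸n≡m i j) (∸-monoʳ-≤ (i + j) p≤j) ,
  subst ((i + j) ∸ p ≤_) (m+n∸m≡n i j) (∸-monoʳ-≤ (i + j) i≤p)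

isPal-transport : ∀ {n} {S T : Vec ℕ n} → PreservesEqualities S T →
  ∀ {i j} → 1 ≤ i → j ≤ n → IsPal S i j → IsPal T i j
isPal-transport (preservesEqualities S⇒T) 1≤i j≤n pal p i≤p p≤j =
  let i≤p′ , p′≤j = mirror-≤ {p = p} i≤p p≤j in
  S⇒T (≤-trans 1≤i i≤p) (≤-trans p≤j j≤n) (≤-trans 1≤i i≤p′) (≤-trans p′≤j j≤n) (pal p i≤p p≤j)

maxPal-transport : ∀ {n} {S T : Vec ℕ n} → PreservesEqualities S T → PreservesEqualities T S →
  ∀ {i j} → MaxPal S i j → MaxPal T i j
maxPal-transport {n} {S} {T} S⇒T T⇒S {i} {j} (1≤i , j≤n , shape , pal , maximal) =
  1≤i , j≤n , shape , isPal-transport S⇒T 1≤i j≤n pal , maximality i maximal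
  where
  maximality : ∀ i → i ≡ 1 ⊎ j ≡ n ⊎ (1 < i × j < n × ¬ IsPal S (i ∸ 1) (suc j)) →
                     i ≡ 1 ⊎ j ≡ n ⊎ (1 < i × j < n × ¬ IsPal T (i ∸ 1) (suc j))
  maximality _ (inj₁ i≡1)         = inj₁ i≡1
  maximality _ (inj₂ (inj₁ j≡n))  = inj₂ (inj₁ j≡n)
  maximality (suc _) (inj₂ (inj₂ (s≤s 1≤i-1 , j<n , ¬palS))) =
    inj₂ (inj₂ (s≤s 1≤i-1 , j<n , λ palT → ¬palS (isPal-transport T⇒S 1≤i-1 j<n palT)))

sameMaxPals-transport : ∀ {n} {S T : Vec ℕ n} → PreservesEqualities S T → PreservesEqualities T S →
  SameMaxPals S T
sameMaxPals-transport S⇒T T⇒S i j = mk⇔ (maxPal-transport S⇒T T⇒S) (maxPal-transport T⇒S S⇒T)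

at-map : ∀ {n} (f : ℕ → ℕ) (S : Vec ℕ n) {p} → 1 ≤ p → p ≤ n → at (map f S) p ≡ f (at S p)
at-map f (x ∷ S) {suc zero}    _ _         = refl
at-map f (x ∷ S) {suc (suc p)} _ (s≤s p<n) = at-map f S (s≤s z≤n) p<n

at-∈ : ∀ {n} (S : Vec ℕ n) {p} → 1 ≤ p → p ≤ n → at S p ∈ᵥ S
at-∈ (x ∷ S) {suc zero}    _ _         = VecAny.here refl
at-∈ (x ∷ S) {suc (suc p)} _ (s≤s p<n) = VecAny.there (at-∈ S (s≤s z≤n) p<n)

map-preservesEqualities : ∀ {n} (f : ℕ → ℕ) (S : Vec ℕ n) → PreservesEqualities S (map f S)
map-preservesEqualities f S = preservesEqualities λ 1≤p p≤n 1≤q q≤n eq →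
  trans (at-map f S 1≤p p≤n) (trans (cong f eq) (sym (at-map f S 1≤q q≤n)))

map-reflectsEqualities : ∀ {n} (f : ℕ → ℕ) (S : Vec ℕ n) →
  (∀ {a b} → a ∈ᵥ S → b ∈ᵥ S → f a ≡ f b → a ≡ b) → PreservesEqualities (map f S) S
map-reflectsEqualities f S f-inj = preservesEqualities λ 1≤p p≤n 1≤q q≤n eq →
  f-inj (at-∈ S 1≤p p≤n) (at-∈ S 1≤q q≤n)
        (trans (sym (at-map f S 1≤p p≤n)) (trans eq (at-map f S 1≤q q≤n)))

sameMaxPals-map : ∀ {n} (f : ℕ → ℕ) (S : Vec ℕ n) →
  (∀ {a b} → a ∈ᵥ S → b ∈ᵥ S → f a ≡ f b → a ≡ b) → SameMaxPals S (map f S)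
sameMaxPals-map f S f-inj =
  sameMaxPals-transport (map-preservesEqualities f S) (map-reflectsEqualities f S f-inj)

module _ {A : Set} (_≟ᴬ_ : DecidableEquality A) where

  indexOf : List A → A → ℕ
  indexOf []       a = 0
  indexOf (x ∷ xs) a with x ≟ᴬ a
  ... | yes _ = 0
  ... | no  _ = suc (indexOf xs a)

  indexOf-< : ∀ {xs a} → a ∈ xs → indexOf xs a < length xs
  indexOf-< {x ∷ xs} {a} a∈x∷xs with x ≟ᴬ a | a∈x∷xs
  ... | yes _   | _          = s≤s z≤n
  ... | no  x≢a | here refl  = contradiction refl x≢a
  ... | no  _   | there a∈xs = s≤s (indexOf-< a∈xs)

  indexOf-injective : ∀ {xs a b} → a ∈ xs → b ∈ xs → indexOf xs a ≡ indexOf xs b → a ≡ b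
  indexOf-injective {x ∷ xs} {a} {b} a∈ b∈ eq with x ≟ᴬ a | x ≟ᴬ b | a∈ | b∈
  ... | yes refl | yes refl | _          | _          = refl
  ... | no  x≢a  | _        | here refl  | _          = contradiction refl x≢a
  ... | _        | no  x≢b  | _          | here refl  = contradiction refl x≢b
  ... | no  _    | no  _    | there a∈xs | there b∈xs = indexOf-injective a∈xs b∈xs (suc-injective eq)

  indexOf-head : ∀ x xs → indexOf (x ∷ xs) x ≡ 0
  indexOf-head x xs with x ≟ᴬ x
  ... | yes _   = refl
  ... | no  x≢x = contradiction refl x≢x

  indexOf-tail : ∀ {x a} xs → x ≢ a → indexOf (x ∷ xs) a ≡ suc (indexOf xs a)
  indexOf-tail {x} {a} xs x≢a with x ≟ᴬ a
  ... | yes x≡a = contradiction x≡a x≢a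
  ... | no  _   = refl

  indexOf-surjective : ∀ {xs m} → Unique xs → m < length xs → ∃[ a ] (a ∈ xs × indexOf xs a ≡ m)
  indexOf-surjective {x ∷ xs} {zero}  _                 _            = x , here refl , indexOf-head x xs
  indexOf-surjective {x ∷ xs} {suc m} (x∉xs ∷ unique) (s≤s m<len) =
    let a , a∈xs , eq = indexOf-surjective unique m<len
    in a , there a∈xs , trans (indexOf-tail xs (ListAll.lookup x∉xs a∈xs)) (cong suc eq)

Covers : ∀ {n} → ℕ → Vec ℕ n → Set
Covers k T = ∀ {a} → a < k → a ∈ᵥ T

covers? : ∀ {n} k (T : Vec ℕ n) → Dec (Covers k T)
covers? k T = allUpTo? (_∈ᵥ? T) k

bounded∧covers⇒distinctSymbols : ∀ {n k} {T : Vec ℕ n} → All (_< k) T → Covers k T → DistinctSymbols T k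
bounded∧covers⇒distinctSymbols {k = k} T<k k⊆T =
  upTo k , upTo⁺ k , length-upTo k ,
  λ a → mk⇔ (λ a∈upTo → k⊆T (∈-upTo⁻ a∈upTo)) (λ a∈T → ∈-upTo⁺ (VecAll.lookup T<k a∈T))

distinctSymbols⇒canonical : ∀ {n k} {T : Vec ℕ n} → DistinctSymbols T k →
  ∃[ T′ ] (SameMaxPals T T′ × All (_< k) T′ × Covers k T′)
distinctSymbols⇒canonical {k = k} {T} (L , unique , refl , L⇔T) =
  map rank T , sameMaxPals-map rank T rank-injective , T′<k , k⊆T′
  where
  rank : ℕ → ℕ
  rank = indexOf _≟_ L

  rank-injective : ∀ {a b} → a ∈ᵥ T → b ∈ᵥ T → rank a ≡ rank b → a ≡ b
  rank-injective a∈T b∈T = indexOf-injective _≟_ (from (L⇔T _) a∈T) (from (L⇔T _) b∈T)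

  T′<k : All (_< k) (map rank T)
  T′<k = map⁺ (lookup⁻ λ i → indexOf-< _≟_ (from (L⇔T _) (∈-lookup i T)))

  k⊆T′ : Covers k (map rank T)
  k⊆T′ m<k with a , a∈L , refl ← indexOf-surjective _≟_ unique m<k = ∈-map⁺ rank (to (L⇔T a) a∈L)

anyString? : ∀ n k {Q : Vec ℕ n → Set} → (∀ T → Dec (Q T)) → Dec (∃[ T ] (All (_< k) T × Q T))
anyString? zero    k Q? = map′ (λ q → [] , [] , q) (λ { ([] , [] , q) → q }) (Q? [])
anyString? (suc n) k Q? =
  map′ (λ (x , x<k , T , T<k , q) → x ∷ T , x<k ∷ T<k , q)
       (λ { (x ∷ T , x<k ∷ T<k , q) → x , x<k , T , T<k , q })
       (anyUpTo? (λ x → anyString? n k (λ T → Q? (x ∷ T))) k)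

theorem4 : (n : ℕ) → 1 ≤ n → (F : List (ℕ × ℕ)) → IsFingerprint n F →
    (k : ℕ) → 1 ≤ k →
    Dec (∃[ T ] (HasFingerprint {n} T F × DistinctSymbols T k))
theorem4 n _ F (S , fpS) k _ = map′ sound complete (anyString? n k (λ T → sameMaxPals? S T ×-dec covers? k T))
  where
  sound : ∃[ T ] (All (_< k) T × SameMaxPals S T × Covers k T) →
          ∃[ T ] (HasFingerprint T F × DistinctSymbols T k)
  sound (T , T<k , same , k⊆T) =
    T , sameMaxPals⇒hasFingerprint S T fpS same , bounded∧covers⇒distinctSymbols T<k k⊆T

  complete : ∃[ T ] (HasFingerprint T F × DistinctSymbols T k) →
             ∃[ T ] (All (_< k) T × SameMaxPals S T × Covers k T)
  complete (T , fpT , distinct) =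
    let T′ , sameTT′ , T′<k , k⊆T′ = distinctSymbols⇒canonical distinct
    in T′ , T′<k , hasFingerprint⇒sameMaxPals S T′ fpS (sameMaxPals⇒hasFingerprint T T′ fpT sameTT′) , k⊆T′
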